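{- Let $T\subseteq\mathbb{Z}^n$ be an integer tiling with $\Upsilon_n$ such that $\mathbf{0}\in T$. Then for each $r$, $1\le r\le n$, the point $2e_r$ is covered by a codeword $X\in T$ (i.e. $2e_r\in X+\Upsilon_n$) where either $X=4e_r$ or $X=3e_r+2e_s$ for some $s\neq r$.
   Context: $e_r$ is the $r$-th unit vector. $\Upsilon_n=\{U\in\mathbb{Z}^n:\sum_i|x_i-u_i|\le1\text{ for some }X\in\{ -1,0\}^n\}$. A set $T\subseteq\mathbb{Z}^n$ is an integer tiling with $\Upsilon_n$ if the translates $X+\Upsilon_n$, $X\in T$, partition $\mathbb{Z}^n$; elements of $T$ are called codewords. -}

module Defs where

open import Data.Nat using (ℕ)
open import Data.Fin using (Fin; _≟_)
open import Data.Integer using (ℤ; +_; -_; _+_; _-_; ∣_∣; 0ℤ; -1ℤ)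
open import Data.Nat using () renaming (_+_ to _+ℕ_; _≤_ to _≤ℕ_)
open import Data.Fin using (zero; suc)
open import Data.Product using (Σ; ∃; _×_; _,_)
open import Data.Sum using (_⊎_)
open import Relation.Binary.PropositionalEquality using (_≡_)
open import Relation.Nullary using (yes; no)

Point : ℕ → Set
Point n = Fin n → ℤ

sumFin : {n : ℕ} → (Fin n → ℕ) → ℕ
sumFin {ℕ.zero} f = 0
sumFin {ℕ.suc n} f = f zero +ℕ sumFin (λ i → f (suc i))

dist1 : {n : ℕ} → Point n → Point n → ℕ
dist1 X U = sumFin (λ i → ∣ X i - U i ∣)

IsCorner : {n : ℕ} → Point n → Set
IsCorner X = ∀ i → (X i ≡ -1ℤ) ⊎ (X i ≡ 0ℤ)

Υ : (n : ℕ) → Point n → Set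
Υ n U = Σ (Point n) λ X → IsCorner X × (dist1 X U ≤ℕ 1)

_⊕_ : {n : ℕ} → Point n → Point n → Point n
(X ⊕ Y) i = X i + Y i

_∈_+Υ : {n : ℕ} → Point n → Point n → Set
_∈_+Υ {n} Z X = Υ n (λ i → Z i - X i)

_≐_ : {n : ℕ} → Point n → Point n → Set
X ≐ Y = ∀ i → X i ≡ Y i

IsTiling : (n : ℕ) → (Point n → Set) → Set
IsTiling n T =
  (∀ (Z : Point n) → Σ (Point n) λ X → T X × (Z ∈ X +Υ)) ×
  (∀ (Z X Y : Point n) → T X → T Y → Z ∈ X +Υ → Z ∈ Y +Υ → X ≐ Y)

𝟎 : {n : ℕ} → Point n
𝟎 i = 0ℤ

scaledUnit : {n : ℕ} → ℤ → Fin n → Point n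
scaledUnit c r i with i ≟ r
... | yes _ = c
... | no _ = 0ℤ

-- An element U of Υₙ is a "box" point: for one exceptional coordinate k, U_k ∈ {-2,-1,0,1},
-- and U_l ∈ {-1,0} for l ≠ k (Box, box⇒Υ, Υ⇒box, via the ℓ¹ sums sumFin).  Hence the
-- codeword covering a point P agrees with P or P + 1 off one coordinate k, where it lies in
-- P_k + {-1,0,1,2} (covering, recover).  Conversely, if |Y_l - W_l| ≤ 1 except for one
-- extra unit at each of two coordinates, the translates W + Υₙ and Y + Υₙ meet, so two such
-- codewords coincide (Near, translates-meet, separated, clash).
-- Separating candidates from the origin, the codeword covering 2e_r is 4e_r + ε (an apex)
-- or 3e_r + 2e_s + ε (a ridge) with ε a 0/1 vector, and the one covering e_r + e_t is a
-- ridge at r, t, a ridge at t, r, or 2e_r + 2e_t + 2e_k + ε.  Separating the first from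
-- the second shows ε_t ≠ 1, i.e. ε = 0, which is the corollary.

module Submission where

open import Defs
open import Data.Nat using (ℕ)
open import Data.Fin using (Fin)
open import Data.Integer using (+_)
open import Data.Product using (Σ; _×_)
open import Data.Sum using (_⊎_)
open import Relation.Nullary using (¬_)
open import Relation.Binary.PropositionalEquality using (_≡_)

open import Function using (_∘_)
open import Data.Nat as ℕ using (zero; suc; _≤_; s≤s)
import Data.Nat.Properties as ℕ
open import Data.Fin using (_≟_) renaming (zero to fzero; suc to fsuc)
open import Data.Fin.Properties using (suc-injective)
open import Data.Integer as ℤ using (ℤ; -[1+_]; _+_; _-_; ∣_∣; 0ℤ; -1ℤ)
import Data.Integer.Properties as ℤ
open import Data.Integer.Tactic.RingSolver using (solve-∀)
open import Data.Bool using (Bool; true; false)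
open import Data.List using (List; []; _∷_; map)
open import Data.List.Relation.Unary.All as All using (all?)
open import Data.List.Relation.Unary.Any using (Any; any?; here; there)
open import Data.List.Membership.Propositional using (find) renaming (_∈_ to _∈ᴸ_)
open import Data.List.Membership.Propositional.Properties using (∈-map⁺)
open import Data.List.Membership.DecPropositional ℤ._≟_ using (_∈?_)
open import Data.Product using (∃; _,_; proj₁; proj₂)
open import Data.Sum using (inj₁; inj₂)
open import Data.Empty using (⊥; ⊥-elim)
open import Relation.Nullary using (Dec; yes; no; does; ¬?)
open import Relation.Nullary.Decidable using (True; toWitness; dec-true; dec-false)
open import Relation.Binary.PropositionalEquality using (_≢_; refl; sym; trans; cong; cong₂; subst; ≢-sym)

sumFin-zero : ∀ {n} (f : Fin n → ℕ) → (∀ l → f l ≡ 0) → sumFin f ≡ 0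
sumFin-zero {zero} f vanish = refl
sumFin-zero {suc n} f vanish rewrite vanish fzero = sumFin-zero (f ∘ fsuc) (vanish ∘ fsuc)

sumFin-zero⁻ : ∀ {n} (f : Fin n → ℕ) → sumFin f ≡ 0 → ∀ l → f l ≡ 0
sumFin-zero⁻ {suc n} f sum≡0 fzero = ℕ.m+n≡0⇒m≡0 (f fzero) sum≡0
sumFin-zero⁻ {suc n} f sum≡0 (fsuc l) = sumFin-zero⁻ (f ∘ fsuc) (ℕ.m+n≡0⇒n≡0 (f fzero) sum≡0) l

sumFin-single : ∀ {n} (f : Fin n → ℕ) (k : Fin n) → (∀ l → l ≢ k → f l ≡ 0) → sumFin f ≡ f k
sumFin-single {suc n} f fzero vanish =
  trans (cong (f fzero ℕ.+_) (sumFin-zero (f ∘ fsuc) (λ l → vanish (fsuc l) λ ())))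
        (ℕ.+-identityʳ (f fzero))
sumFin-single {suc n} f (fsuc k) vanish =
  trans (cong (ℕ._+ sumFin (f ∘ fsuc)) (vanish fzero λ ()))
        (sumFin-single (f ∘ fsuc) k (λ l l≢k → vanish (fsuc l) (l≢k ∘ suc-injective)))

vanishing-or-single : ∀ {n} (f : Fin n → ℕ) → sumFin f ≤ 1 →
  (∀ l → f l ≡ 0) ⊎ Σ (Fin n) λ k → ∀ l → l ≢ k → f l ≡ 0
vanishing-or-single {zero} f _ = inj₁ λ ()
vanishing-or-single {suc n} f sum≤1 with f fzero in head≡
... | zero with vanishing-or-single (f ∘ fsuc) sum≤1
...   | inj₁ rest = inj₁ λ { fzero → head≡ ; (fsuc l) → rest l }
...   | inj₂ (k , rest) = inj₂ (fsuc k , λ { fzero _ → head≡ ; (fsuc l) l≢k → rest l (l≢k ∘ cong fsuc) })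
vanishing-or-single {suc n} f sum≤1 | suc zero = inj₂ (fzero , λ
  { fzero l≢0 → ⊥-elim (l≢0 refl)
  ; (fsuc l) _ → sumFin-zero⁻ (f ∘ fsuc) (ℕ.n≤0⇒n≡0 (ℕ.+-cancelˡ-≤ 1 _ _ sum≤1)) l })
vanishing-or-single {suc n} f (s≤s ()) | suc (suc _)

concentrated : ∀ {n} (f : Fin n → ℕ) → Fin n → sumFin f ≤ 1 → Σ (Fin n) λ k → ∀ l → l ≢ k → f l ≡ 0
concentrated f r sum≤1 with vanishing-or-single f sum≤1
... | inj₁ vanish = r , λ l _ → vanish l
... | inj₂ single = single

by-enumeration : ∀ {P : ℤ → Set} (P? : ∀ x → Dec (P x)) xs →
  {True (all? P? xs)} → ∀ {a} → a ∈ᴸ xs → P a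
by-enumeration P? xs {checked} = All.lookup (toWitness checked)

by-enumeration₂ : ∀ {R : ℤ → ℤ → Set} (R? : ∀ x y → Dec (R x y)) xs ys →
  {True (all? (λ x → all? (R? x) ys) xs)} → ∀ {a b} → a ∈ᴸ xs → b ∈ᴸ ys → R a b
by-enumeration₂ R? xs ys {checked} a∈ = All.lookup (by-enumeration (λ x → all? (R? x) ys) xs {checked} a∈)

within : ∀ m {xs ys} → {True (all? (λ x → all? (λ y → ∣ x - y ∣ ℕ.≤? m) ys) xs)} →
  ∀ {a b} → a ∈ᴸ xs → b ∈ᴸ ys → ∣ a - b ∣ ≤ m
within m {xs} {ys} {checked} = by-enumeration₂ (λ x y → ∣ x - y ∣ ℕ.≤? m) xs ys {checked}

distinct : ∀ {xs ys} → {True (all? (λ x → all? (λ y → ¬? (x ℤ.≟ y)) ys) xs)} →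
  ∀ {a b} → a ∈ᴸ xs → b ∈ᴸ ys → a ≢ b
distinct {xs} {ys} {checked} = by-enumeration₂ (λ x y → ¬? (x ℤ.≟ y)) xs ys {checked}

single : ∀ {a c : ℤ} → a ≡ c → a ∈ᴸ (c ∷ [])
single = here

window : ℕ → List ℤ
window zero = 0ℤ ∷ []
window (suc m) = + suc m ∷ -[1+ m ] ∷ window m

window-complete : ∀ {m} v → ∣ v ∣ ≤ m → v ∈ᴸ window m
window-complete {zero} (+ zero) _ = here refl
window-complete {suc m} (+ k) k≤1+m with ℕ.m≤n⇒m<n∨m≡n k≤1+m
... | inj₁ (s≤s k≤m) = there (there (window-complete (+ k) k≤m))
... | inj₂ refl = here refl
window-complete {suc m} -[1+ k ] k<1+m with ℕ.m≤n⇒m<n∨m≡n k<1+m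
... | inj₁ (s≤s k<m) = there (there (window-complete -[1+ k ] k<m))
... | inj₂ refl = there (here refl)

cancel : ∀ (c x : ℤ) → c - (c - x) ≡ x
cancel = solve-∀

-- Coordinate values of an element of Υₙ: I₂ in general, I₄ at the exceptional coordinate.
I₂ I₄ bits : List ℤ
I₂ = -1ℤ ∷ 0ℤ ∷ []
I₄ = -[1+ 1 ] ∷ -1ℤ ∷ 0ℤ ∷ + 1 ∷ []
bits = + 1 ∷ 0ℤ ∷ []

I : Bool → List ℤ
I true = I₄
I false = I₂

Box : ∀ {n} → Fin n → Point n → Set
Box k U = U k ∈ᴸ I₄ × (∀ l → l ≢ k → U l ∈ᴸ I₂)

box-from-flags : ∀ {n} {k} {U : Point n} → (∀ l → U l ∈ᴸ I (does (l ≟ k))) → Box k U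
box-from-flags {k = k} {U} flagged =
  subst (λ b → U k ∈ᴸ I b) (dec-true (k ≟ k) refl) (flagged k) ,
  λ l l≢k → subst (λ b → U l ∈ᴸ I b) (dec-false (l ≟ k) l≢k) (flagged l)

round : ℤ → ℤ
round (+ _) = 0ℤ
round -[1+ _ ] = -1ℤ

round-corner : ∀ u → (round u ≡ -1ℤ) ⊎ (round u ≡ 0ℤ)
round-corner (+ _) = inj₂ refl
round-corner -[1+ _ ] = inj₁ refl

corner-value : ∀ {c} → (c ≡ -1ℤ) ⊎ (c ≡ 0ℤ) → c ∈ᴸ I₂
corner-value (inj₁ c≡-1) = here c≡-1
corner-value (inj₂ c≡0) = there (here c≡0)

-- A box lies in Υₙ: round it to a corner; only the exceptional coordinate moves, by ≤ 1.
box⇒Υ : ∀ {n} {k} {U : Point n} → Box k U → Υ n U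
box⇒Υ {n} {k} {U} (exceptional , regular) =
  (λ l → round (U l)) , (λ l → round-corner (U l)) ,
  subst (_≤ 1) (sym (sumFin-single _ k (λ l l≢k → exact (regular l l≢k)))) (close exceptional)
  where
  exact : ∀ {u} → u ∈ᴸ I₂ → ∣ round u - u ∣ ≡ 0
  exact = by-enumeration (λ x → ∣ round x - x ∣ ℕ.≟ 0) I₂
  close : ∀ {u} → u ∈ᴸ I₄ → ∣ round u - u ∣ ≤ 1
  close = by-enumeration (λ x → ∣ round x - x ∣ ℕ.≤? 1) I₄

-- Conversely every element of Υₙ lies in a box: the ℓ¹ distance ≤ 1 to its corner is
-- concentrated at one coordinate k (any fallback index r if it is 0).
Υ⇒box : ∀ {n} {U : Point n} → Fin n → Υ n U → Σ (Fin n) λ k → Box k U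
Υ⇒box {U = U} r (C , corner , dist≤1) with concentrated _ r dist≤1
... | k , vanish = k , exceptional , λ l l≢k → regular l (vanish l l≢k)
  where
  regular : ∀ l → ∣ C l - U l ∣ ≡ 0 → U l ∈ᴸ I₂
  regular l d≡0 = subst (_∈ᴸ I₂) (ℤ.i-j≡0⇒i≡j _ _ (ℤ.∣i∣≡0⇒i≡0 d≡0)) (corner-value (corner l))
  shifted : ∀ {c d} → c ∈ᴸ I₂ → d ∈ᴸ window 1 → c - d ∈ᴸ I₄
  shifted = by-enumeration₂ (λ c d → (c - d) ∈? I₄) I₂ (window 1)
  exceptional : U k ∈ᴸ I₄
  exceptional = subst (_∈ᴸ I₄) (cancel (C k) (U k))
    (shifted (corner-value (corner k))
      (window-complete _ (subst (_≤ 1) (sumFin-single _ k vanish) dist≤1)))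

weight : Bool → ℕ
weight true = 1
weight false = 0

budget : ∀ {n} → Fin n → Fin n → Fin n → ℕ
budget i j l = 1 ℕ.+ weight (does (l ≟ i)) ℕ.+ weight (does (l ≟ j))

record Near {n} (W Y : Point n) (i j : Fin n) : Set where
  constructor within-budget
  field distance-bound : ∀ l → ∣ Y l - W l ∣ ≤ budget i j l

Meets : Bool → Bool → ℤ → Set
Meets bi bj v = Any (λ a → (a - v) ∈ᴸ I bi) (I bj)

meets? : ∀ bi bj v → Dec (Meets bi bj v)
meets? bi bj v = any? (λ a → (a - v) ∈? I bi) (I bj)

meets : ∀ bi bj {v} → ∣ v ∣ ≤ 1 ℕ.+ weight bi ℕ.+ weight bj → Meets bi bj v
meets false false v≤ = by-enumeration (meets? false false) (window 1) (window-complete _ v≤)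
meets false true v≤ = by-enumeration (meets? false true) (window 2) (window-complete _ v≤)
meets true false v≤ = by-enumeration (meets? true false) (window 2) (window-complete _ v≤)
meets true true v≤ = by-enumeration (meets? true true) (window 3) (window-complete _ v≤)

translates-meet : ∀ {n} {W Y : Point n} {i j} → Near W Y i j → Σ (Point n) λ Z → (Z ∈ W +Υ) × (Z ∈ Y +Υ)
translates-meet {W = W} {Y} {i} {j} near = Z , box⇒Υ (box-from-flags from-W) , box⇒Υ (box-from-flags from-Y)
  where
  witness : ∀ l → ∃ λ a → a ∈ᴸ I (does (l ≟ j)) × (a - (Y l - W l)) ∈ᴸ I (does (l ≟ i))
  witness l = find (meets _ _ (Near.distance-bound near l))
  Z : Point _
  Z l = W l + proj₁ (witness l)
  offset-W : ∀ (w a : ℤ) → (w + a) - w ≡ a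
  offset-W = solve-∀
  offset-Y : ∀ (w a y : ℤ) → (w + a) - y ≡ a - (y - w)
  offset-Y = solve-∀
  from-W : ∀ l → Z l - W l ∈ᴸ I (does (l ≟ j))
  from-W l = subst (_∈ᴸ _) (sym (offset-W (W l) _)) (proj₁ (proj₂ (witness l)))
  from-Y : ∀ l → Z l - Y l ∈ᴸ I (does (l ≟ i))
  from-Y l = subst (_∈ᴸ _) (sym (offset-Y (W l) _ (Y l))) (proj₂ (proj₂ (witness l)))

separated : ∀ {n} {T : Point n → Set} → IsTiling n T →
  ∀ {W Y i j} → T W → T Y → Near W Y i j → W ≐ Y
separated tiling tW tY near with translates-meet near
... | Z , Z∈W+Υ , Z∈Y+Υ = proj₂ tiling Z _ _ tW tY Z∈W+Υ Z∈Y+Υ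

clash : ∀ {n} {T : Point n → Set} → IsTiling n T →
  ∀ {W Y i j} → T W → T Y → Near W Y i j →
  ∀ {l xs ys} → {True (all? (λ x → all? (λ y → ¬? (x ℤ.≟ y)) ys) xs)} →
  W l ∈ᴸ xs → Y l ∈ᴸ ys → ⊥
clash tiling tW tY near {l} {xs} {ys} {checked} W∈ Y∈ =
  distinct {xs} {ys} {checked} W∈ Y∈ (separated tiling tW tY near l)

near₁ : ∀ {n} {W Y : Point n} {i} → ∣ Y i - W i ∣ ≤ 3 →
  (∀ l → l ≢ i → ∣ Y l - W l ∣ ≤ 1) → Near W Y i i
near₁ {W = W} {Y} {i} at-i elsewhere = within-budget bound
  where
  bound : ∀ l → ∣ Y l - W l ∣ ≤ budget i i l
  bound l with l ≟ i
  ... | yes refl = at-i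
  ... | no l≢i = elsewhere l l≢i

near₂ : ∀ {n} {W Y : Point n} {i j} → i ≢ j → ∣ Y i - W i ∣ ≤ 2 → ∣ Y j - W j ∣ ≤ 2 →
  (∀ l → l ≢ i → l ≢ j → ∣ Y l - W l ∣ ≤ 1) → Near W Y i j
near₂ {W = W} {Y} {i} {j} i≢j at-i at-j elsewhere = within-budget bound
  where
  bound : ∀ l → ∣ Y l - W l ∣ ≤ budget i j l
  bound l with l ≟ i | l ≟ j
  ... | yes refl | yes refl = ⊥-elim (i≢j refl)
  ... | yes refl | no _ = at-i
  ... | no _ | yes refl = at-j
  ... | no l≢i | no l≢j = elsewhere l l≢i l≢j

split-at : ∀ {n} {P : Fin n → Set} a → P a → (∀ l → l ≢ a → P l) → ∀ l → P l
split-at a at-a elsewhere l with l ≟ a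
... | yes refl = at-a
... | no l≢a = elsewhere l l≢a

split-at₂ : ∀ {n} {P : Fin n → Set} a b → P a → P b → (∀ l → l ≢ a → l ≢ b → P l) → ∀ l → P l
split-at₂ a b at-a at-b elsewhere l with l ≟ a | l ≟ b
... | yes refl | _ = at-a
... | no _ | yes refl = at-b
... | no l≢a | no l≢b = elsewhere l l≢a l≢b

small : ∀ m {xs} → {True (all? (λ x → all? (λ y → ∣ x - y ∣ ℕ.≤? m) (0ℤ ∷ [])) xs)} →
  ∀ {a} → a ∈ᴸ xs → ∣ a - 0ℤ ∣ ≤ m
small m {xs} {checked} a∈ = within m {xs} {0ℤ ∷ []} {checked} a∈ (here refl)

recover : ∀ {p x c : ℤ} {xs} → p - x ∈ᴸ xs → p ≡ c → x ∈ᴸ map (c -_) xs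
recover {p} {x} p-x∈ refl = subst (_∈ᴸ _) (cancel p x) (∈-map⁺ (p -_) p-x∈)

covering : ∀ {n} {T : Point n → Set} → IsTiling n T → (P : Point n) → Fin n →
  Σ (Point n) λ X → T X × (P ∈ X +Υ) × Σ (Fin n) λ k → Box k (λ l → P l - X l)
covering tiling P r with proj₁ tiling P
... | X , tX , P∈X+Υ = X , tX , P∈X+Υ , Υ⇒box r P∈X+Υ

unit-at : ∀ {n} c (r : Fin n) → scaledUnit c r r ≡ c
unit-at c r with r ≟ r
... | yes _ = refl
... | no r≢r = ⊥-elim (r≢r refl)

unit-off : ∀ {n} c (r l : Fin n) → l ≢ r → scaledUnit c r l ≡ 0ℤ
unit-off c r l l≢r with l ≟ r
... | yes l≡r = ⊥-elim (l≢r l≡r)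
... | no _ = refl

module NearOrigin {n} {T : Point n → Set} (tiling : IsTiling n T) (origin : T 𝟎) where

  at-origin : 0ℤ ∈ᴸ (0ℤ ∷ [])
  at-origin = here refl

  Apex : Fin n → Point n → Set
  Apex r X = X r ≡ + 4 × (∀ l → l ≢ r → X l ∈ᴸ bits)

  Ridge : Fin n → Fin n → Point n → Set
  Ridge r s X = s ≢ r × X r ≡ + 3 × X s ≡ + 2 × (∀ l → l ≢ r → l ≢ s → X l ∈ᴸ bits)

  -- The codeword covering 2e_r is an apex or a ridge at r: every other shape that the
  -- covering leaves possible is within the budget of the origin.
  cover-2e : (r : Fin n) → Σ (Point n) λ X → T X × (scaledUnit (+ 2) r ∈ X +Υ) ×
    (Apex r X ⊎ Σ (Fin n) λ s → Ridge r s X)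
  cover-2e r with covering tiling (scaledUnit (+ 2) r) r
  ... | X , tX , covered , k , exceptional , regular = X , tX , covered , shape (k ≟ r)
    where
    tail : ∀ l → l ≢ r → l ≢ k → X l ∈ᴸ bits
    tail l l≢r l≢k = recover (regular l l≢k) (unit-off (+ 2) r l l≢r)
    shape : Dec (k ≡ r) → Apex r X ⊎ Σ (Fin n) λ s → Ridge r s X
    shape (yes refl) with recover exceptional (unit-at (+ 2) r)
    ... | here x≡4 = inj₁ (x≡4 , λ l l≢r → tail l l≢r l≢r)
    ... | there x≤3 = ⊥-elim (clash tiling origin tX
            (near₁ (small 3 x≤3) (λ l l≢r → small 1 (tail l l≢r l≢r))) at-origin x≤3)
    shape (no k≢r) with recover (regular r (≢-sym k≢r)) (unit-at (+ 2) r)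
                      | recover exceptional (unit-off (+ 2) r k k≢r)
    ... | here xr≡3 | here xk≡2 = inj₂ (k , k≢r , xr≡3 , xk≡2 , tail)
    ... | here xr≡3 | there xk≤1 = ⊥-elim (clash tiling origin tX
            (near₁ (small 3 (single xr≡3))
              (split-at k (λ _ → small 1 xk≤1) (λ l l≢k l≢r → small 1 (tail l l≢r l≢k))))
            at-origin (single xr≡3))
    ... | there xr≡2 | xk = ⊥-elim (clash tiling origin tX
            (near₂ (≢-sym k≢r) (small 2 xr≡2) (small 2 xk) (λ l l≢r l≢k → small 1 (tail l l≢r l≢k)))
            at-origin xr≡2)

  pair : Fin n → Fin n → Point n
  pair r t = scaledUnit (+ 1) r ⊕ scaledUnit (+ 1) t

  Triad : Fin n → Fin n → Point n → Set
  Triad r t Y = Σ (Fin n) λ k → k ≢ r × k ≢ t × Y r ≡ + 2 × Y t ≡ + 2 × Y k ≡ + 2 ×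
    (∀ l → l ≢ r → l ≢ t → l ≢ k → Y l ∈ᴸ bits)

  lead : ∀ {Y r t} → t ≢ r → T Y → Y r ∈ᴸ map (+ 1 -_) I₄ → Y t ∈ᴸ map (+ 1 -_) I₂ →
    (∀ l → l ≢ r → l ≢ t → Y l ∈ᴸ bits) → Ridge r t Y
  lead t≢r tY (here yr≡3) (here yt≡2) tail = t≢r , yr≡3 , yt≡2 , tail
  lead {t = t} t≢r tY (here yr≡3) (there yt≡1) tail = ⊥-elim (clash tiling origin tY
    (near₁ (small 3 (single yr≡3))
      (split-at t (λ _ → small 1 yt≡1) (λ l l≢t l≢r → small 1 (tail l l≢r l≢t))))
    at-origin (single yr≡3))
  lead t≢r tY (there yr≤2) yt tail = ⊥-elim (clash tiling origin tY
    (near₂ (≢-sym t≢r) (small 2 yr≤2) (small 2 yt) (λ l l≢r l≢t → small 1 (tail l l≢r l≢t)))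
    at-origin yt)

  triad : ∀ {Y r t k} → k ≢ r → k ≢ t → r ≢ t → T Y →
    Y r ∈ᴸ map (+ 1 -_) I₂ → Y t ∈ᴸ map (+ 1 -_) I₂ → Y k ∈ᴸ map (0ℤ -_) I₄ →
    (∀ l → l ≢ r → l ≢ t → l ≢ k → Y l ∈ᴸ bits) → Triad r t Y
  triad {k = k} k≢r k≢t r≢t tY (here yr≡2) (here yt≡2) (here yk≡2) tail =
    k , k≢r , k≢t , yr≡2 , yt≡2 , yk≡2 , tail
  triad {t = t} k≢r k≢t r≢t tY (here yr≡2) (there yt≡1) (here yk≡2) tail = ⊥-elim (clash tiling origin tY
    (near₂ (≢-sym k≢r) (small 2 (single yr≡2)) (small 2 (single yk≡2))
      (split-at t (λ _ _ → small 1 yt≡1) (λ l l≢t l≢r l≢k → small 1 (tail l l≢r l≢t l≢k))))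
    at-origin (single yr≡2))
  triad {r = r} k≢r k≢t r≢t tY (there yr≡1) yt (here yk≡2) tail = ⊥-elim (clash tiling origin tY
    (near₂ (≢-sym k≢t) (small 2 yt) (small 2 (single yk≡2))
      (split-at r (λ _ _ → small 1 yr≡1) (λ l l≢r l≢t l≢k → small 1 (tail l l≢r l≢t l≢k))))
    at-origin yr≡1)
  triad {k = k} k≢r k≢t r≢t tY yr yt (there yk≤1) tail = ⊥-elim (clash tiling origin tY
    (near₂ r≢t (small 2 yr) (small 2 yt)
      (split-at k (λ _ _ → small 1 yk≤1) (λ l l≢k l≢r l≢t → small 1 (tail l l≢r l≢t l≢k))))
    at-origin yr)

  cover-pair : ∀ {r t} → t ≢ r → Σ (Point n) λ Y → T Y × (Ridge r t Y ⊎ Ridge t r Y ⊎ Triad r t Y)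
  cover-pair {r} {t} t≢r with covering tiling (pair r t) r
  ... | Y , tY , _ , k , exceptional , regular = Y , tY , shape (k ≟ r) (k ≟ t)
    where
    at-r : pair r t r ≡ + 1
    at-r = cong₂ _+_ (unit-at (+ 1) r) (unit-off (+ 1) t r (≢-sym t≢r))
    at-t : pair r t t ≡ + 1
    at-t = cong₂ _+_ (unit-off (+ 1) r t t≢r) (unit-at (+ 1) t)
    elsewhere : ∀ l → l ≢ r → l ≢ t → pair r t l ≡ 0ℤ
    elsewhere l l≢r l≢t = cong₂ _+_ (unit-off (+ 1) r l l≢r) (unit-off (+ 1) t l l≢t)
    tail : ∀ l → l ≢ r → l ≢ t → l ≢ k → Y l ∈ᴸ bits
    tail l l≢r l≢t l≢k = recover (regular l l≢k) (elsewhere l l≢r l≢t)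
    shape : Dec (k ≡ r) → Dec (k ≡ t) → Ridge r t Y ⊎ Ridge t r Y ⊎ Triad r t Y
    shape (yes refl) _ = inj₁ (lead t≢r tY (recover exceptional at-r)
      (recover (regular t t≢r) at-t) (λ l l≢r l≢t → tail l l≢r l≢t l≢r))
    shape (no k≢r) (yes refl) = inj₂ (inj₁ (lead (≢-sym t≢r) tY (recover exceptional at-t)
      (recover (regular r (≢-sym t≢r)) at-r) (λ l l≢t l≢r → tail l l≢r l≢t l≢t)))
    shape (no k≢r) (no k≢t) = inj₂ (inj₂ (triad k≢r k≢t (≢-sym t≢r) tY
      (recover (regular r (≢-sym k≢r)) at-r) (recover (regular t (≢-sym k≢t)) at-t)
      (recover exceptional (elsewhere k k≢r k≢t)) tail))

  -- In an apex codeword at r no coordinate t ≠ r equals 1: otherwise X would be within the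
  -- budget of the codeword covering e_r + e_t, from which it differs.
  apex-tail : ∀ {X r} → T X → Apex r X → ∀ {t} → t ≢ r → X t ≢ + 1
  apex-tail tX (xr≡4 , xbits) {t} t≢r xt≡1 with cover-pair t≢r
  ... | Y , tY , inj₁ (_ , yr≡3 , yt≡2 , ybits) = clash tiling tX tY
    (near₁ (within 3 (single yr≡3) (single xr≡4))
      (split-at t (λ _ → within 1 (single yt≡2) (single xt≡1))
        (λ l l≢t l≢r → within 1 (ybits l l≢r l≢t) (xbits l l≢r))))
    (single xt≡1) (single yt≡2)
  ... | Y , tY , inj₂ (inj₁ (_ , yt≡3 , yr≡2 , ybits)) = clash tiling tX tY
    (near₂ (≢-sym t≢r) (within 2 (single yr≡2) (single xr≡4))
                       (within 2 (single yt≡3) (single xt≡1))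
      (λ l l≢r l≢t → within 1 (ybits l l≢t l≢r) (xbits l l≢r)))
    (single xr≡4) (single yr≡2)
  ... | Y , tY , inj₂ (inj₂ (k , k≢r , k≢t , yr≡2 , yt≡2 , yk≡2 , ybits)) = clash tiling tX tY
    (near₂ (≢-sym k≢r) (within 2 (single yr≡2) (single xr≡4))
                       (within 2 (single yk≡2) (xbits k k≢r))
      (split-at t (λ _ _ → within 1 (single yt≡2) (single xt≡1))
        (λ l l≢t l≢r l≢k → within 1 (ybits l l≢r l≢t l≢k) (xbits l l≢r))))
    (single xr≡4) (single yr≡2)

  ridge-tail : ∀ {X r s} → T X → Ridge r s X → ∀ {t} → t ≢ r → t ≢ s → X t ≢ + 1
  ridge-tail {r = r} {s} tX (s≢r , xr≡3 , xs≡2 , xbits) {t} t≢r t≢s xt≡1 with cover-pair t≢r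
  ... | Y , tY , inj₁ (_ , yr≡3 , yt≡2 , ybits) = clash tiling tX tY
    (near₁ (within 3 (ybits s s≢r (≢-sym t≢s)) (single xs≡2))
      (split-at₂ r t (λ _ → within 1 (single yr≡3) (single xr≡3))
                     (λ _ → within 1 (single yt≡2) (single xt≡1))
        (λ l l≢r l≢t l≢s → within 1 (ybits l l≢r l≢t) (xbits l l≢r l≢s))))
    (single xt≡1) (single yt≡2)
  ... | Y , tY , inj₂ (inj₁ (_ , yt≡3 , yr≡2 , ybits)) = clash tiling tX tY
    (near₂ t≢s (within 2 (single yt≡3) (single xt≡1))
               (within 2 (ybits s (≢-sym t≢s) s≢r) (single xs≡2))
      (split-at r (λ _ _ → within 1 (single yr≡2) (single xr≡3))
        (λ l l≢r l≢t l≢s → within 1 (ybits l l≢t l≢r) (xbits l l≢r l≢s))))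
    (single xt≡1) (single yt≡3)
  ... | Y , tY , inj₂ (inj₂ (k , k≢r , k≢t , yr≡2 , yt≡2 , yk≡2 , ybits)) with k ≟ s
  ...   | yes refl = clash tiling tX tY
    (near₁ (within 3 (single yr≡2) (single xr≡3))
      (split-at₂ t k (λ _ → within 1 (single yt≡2) (single xt≡1))
                     (λ _ → within 1 (single yk≡2) (single xs≡2))
        (λ l l≢t l≢k l≢r → within 1 (ybits l l≢r l≢t l≢k) (xbits l l≢r l≢k))))
    (single xt≡1) (single yt≡2)
  ...   | no k≢s = clash tiling tX tY
    (near₂ k≢s (within 2 (single yk≡2) (xbits k k≢r k≢s))
               (within 2 (ybits s s≢r (≢-sym t≢s) (≢-sym k≢s)) (single xs≡2))
      (split-at₂ r t (λ _ _ → within 1 (single yr≡2) (single xr≡3))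
                     (λ _ _ → within 1 (single yt≡2) (single xt≡1))
        (λ l l≢r l≢t l≢k l≢s → within 1 (ybits l l≢r l≢t l≢k) (xbits l l≢r l≢s))))
    (single xt≡1) (single yt≡2)

  bit-zero : ∀ {a} → a ∈ᴸ bits → a ≢ + 1 → a ≡ 0ℤ
  bit-zero (here a≡1) a≢1 = ⊥-elim (a≢1 a≡1)
  bit-zero (there (here a≡0)) _ = a≡0

  apex-exact : ∀ {X r} → T X → Apex r X → X ≐ scaledUnit (+ 4) r
  apex-exact {r = r} tX apex@(xr≡4 , xbits) = split-at r
    (trans xr≡4 (sym (unit-at (+ 4) r)))
    (λ l l≢r → trans (bit-zero (xbits l l≢r) (apex-tail tX apex l≢r)) (sym (unit-off (+ 4) r l l≢r)))

  ridge-exact : ∀ {X r s} → T X → Ridge r s X → X ≐ (scaledUnit (+ 3) r ⊕ scaledUnit (+ 2) s)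
  ridge-exact {r = r} {s} tX ridge@(s≢r , xr≡3 , xs≡2 , xbits) = split-at₂ r s
    (trans xr≡3 (sym (cong₂ _+_ (unit-at (+ 3) r) (unit-off (+ 2) s r (≢-sym s≢r)))))
    (trans xs≡2 (sym (cong₂ _+_ (unit-off (+ 3) r s s≢r) (unit-at (+ 2) s))))
    (λ l l≢r l≢s → trans (bit-zero (xbits l l≢r l≢s) (ridge-tail tX ridge l≢r l≢s))
      (sym (cong₂ _+_ (unit-off (+ 3) r l l≢r) (unit-off (+ 2) s l l≢s))))

corollary4 : (n : ℕ) (T : Point n → Set) → IsTiling n T → T 𝟎 →
    (r : Fin n) →
      Σ (Point n) λ X → T X × (scaledUnit (+ 2) r ∈ X +Υ) ×
        ((X ≐ scaledUnit (+ 4) r) ⊎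
         (Σ (Fin n) λ s → (¬ s ≡ r) × (X ≐ (scaledUnit (+ 3) r ⊕ scaledUnit (+ 2) s))))
corollary4 n T tiling origin r with NearOrigin.cover-2e tiling origin r
... | X , tX , covered , inj₁ apex =
  X , tX , covered , inj₁ (NearOrigin.apex-exact tiling origin tX apex)
... | X , tX , covered , inj₂ (s , ridge) =
  X , tX , covered , inj₂ (s , proj₁ ridge , NearOrigin.ridge-exact tiling origin tX ridge)
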